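{- Let $\mathcal{T}_0=\{T^\flat,T^\dagger,T^\ddagger,T^\sharp\}$ and $\mathcal{T}_{k+1}=\{S\otimes T: S,T\in\mathcal{T}_k\}$ for $k\geqslant0$. Then for every $k\geqslant 0$ and every $S\in\mathcal{T}_k$, $$3\cdot 2^k+k+1\leqslant \delta(S)\leqslant 6\cdot 2^k+k+1.$$
   Context: Let $S=\{0,1,*\}$; elements of $S^d$ are strings of length $d$. A list is a finite sequence of strings all of the same length (repetitions allowed); $|L|$ is its number of entries; $[x]$ is the one-entry list of the string $x$; $*^m$ is the string of $m$ jokers $*$. Operations: pairing $[v_1,\dots,v_n]\ominus[w_1,\dots,w_n]=[v_1w_1,\dots,v_nw_n]$; concatenation $AB=[v_iw_j]$ (all pairs, ordered lexicographically in $(i,j)$); sum $A+B$ = entries of $A$ followed by entries of $B$; $1\cdot A=A$, $(k+1)\cdot A=k\cdot A+A$; concatenation before sum. For a triple of lists $T=(A,B,C)$: $\alpha(T)$, $\beta(T)$ are the lengths of the strings in $A$, $B$; $\delta(T)=\alpha(T)+\beta(T)$; $g(T)=|C|$. The compound of triples $T=(A,B,C)$, $T'=(A',B',C')$ with $\alpha(T)=\alpha(T')$ is $T\otimes T'=(A'',B'',C'')$ with $A''=[0]A+[0]A'+[1]\big((g(T)g(T'))\cdot[*^{\alpha(T)}]\big)$, $B''=[0]B[*^{\beta(T')}]+[1][*^{\beta(T)}]B'+[*]CC'$, $C''=[0]C[*^{\beta(T')}]+[1][*^{\beta(T)}]C'$. Let $G=[0,1]$, $H=[00,01,1*]$, $L=[000,001,01*,1**]$.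 Define $T^\flat=(3\cdot[00]+3\cdot[01]+3\cdot[1*],\ 3\cdot H,\ H)$; $T^\dagger=(4\cdot[00]+4\cdot[01]+4\cdot[1*],\ 3\cdot L,\ L)$; $T^\ddagger=(2\cdot[00]+2\cdot[01]+3\cdot[00]+3\cdot[01]+6\cdot[1*],\ 2\cdot([0]G[**])+2\cdot([1][*]H)+[*]GH,\ [0]G[**]+[1][*]H)$; $T^\sharp=(2\cdot(3\cdot[00]+3\cdot[01])+9\cdot[1*],\ 2\cdot([0]H[**])+2\cdot([1][**]H)+[*]HH,\ [0]H[**]+[1][**]H)$. -}

module Defs where

open import Data.Nat using (ℕ; zero; suc; _+_; _*_)
open import Data.List using (List; []; _∷_; _++_; concatMap; map)
open import Data.Vec using (Vec; replicate) renaming ([] to ⟨⟩; _∷_ to _∷ᵛ_; _++_ to _++ᵛ_)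
open import Relation.Binary.PropositionalEquality using (_≡_; subst; sym)

data Sym : Set where
  𝟘 𝟙 ⋆ : Sym

Lst : ℕ → Set
Lst n = List (Vec Sym n)

[_] : ∀ {n} → Vec Sym n → Lst n
[ x ] = x ∷ []

stars : (m : ℕ) → Vec Sym m
stars m = replicate m ⋆

_⊙_ : ∀ {m n} → Lst m → Lst n → Lst (m + n)
V ⊙ W = concatMap (λ v → map (λ w → v ++ᵛ w) W) V
infixl 7 _⊙_

_⊕_ : ∀ {n} → Lst n → Lst n → Lst n
A ⊕ B = A ++ B
infixl 5 _⊕_

_·_ : ∀ {n} → ℕ → Lst n → Lst n
zero · A = []
suc k · A = (k · A) ⊕ A
infixl 6 _·_

[0] [1] [*] : Lst 1
[0] = [ 𝟘 ∷ᵛ ⟨⟩ ]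
[1] = [ 𝟙 ∷ᵛ ⟨⟩ ]
[*] = [ ⋆ ∷ᵛ ⟨⟩ ]

record Triple : Set where
  constructor triple
  field
    α β : ℕ
    A : Lst α
    B : Lst β
    C : Lst β
open Triple public

δ : Triple → ℕ
δ T = α T + β T

g : Triple → ℕ
g T = Data.List.length (C T)

compound : (T T' : Triple) → α T ≡ α T' → Triple
compound T T' e = triple (suc (α T)) (suc (β T + β T')) A'' B'' C''
  where
    A' : Lst (α T)
    A' = subst Lst (sym e) (A T')
    A'' : Lst (suc (α T))
    A'' = [0] ⊙ A T ⊕ [0] ⊙ A' ⊕ [1] ⊙ ((g T * g T') · [ stars (α T) ])
    B'' : Lst (suc (β T + β T'))
    B'' = [0] ⊙ B T ⊙ [ stars (β T') ] ⊕ [1] ⊙ [ stars (β T) ] ⊙ B T' ⊕ [*] ⊙ C T ⊙ C T'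
    C'' : Lst (suc (β T + β T'))
    C'' = [0] ⊙ C T ⊙ [ stars (β T') ] ⊕ [1] ⊙ [ stars (β T) ] ⊙ C T'

G : Lst 1
G = [0] ⊕ [1]

H : Lst 2
H = [ 𝟘 ∷ᵛ 𝟘 ∷ᵛ ⟨⟩ ] ⊕ [ 𝟘 ∷ᵛ 𝟙 ∷ᵛ ⟨⟩ ] ⊕ [ 𝟙 ∷ᵛ ⋆ ∷ᵛ ⟨⟩ ]

L : Lst 3
L = [ 𝟘 ∷ᵛ 𝟘 ∷ᵛ 𝟘 ∷ᵛ ⟨⟩ ] ⊕ [ 𝟘 ∷ᵛ 𝟘 ∷ᵛ 𝟙 ∷ᵛ ⟨⟩ ] ⊕ [ 𝟘 ∷ᵛ 𝟙 ∷ᵛ ⋆ ∷ᵛ ⟨⟩ ] ⊕ [ 𝟙 ∷ᵛ ⋆ ∷ᵛ ⋆ ∷ᵛ ⟨⟩ ]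

[00] [01] [1*] [**] : Lst 2
[00] = [ 𝟘 ∷ᵛ 𝟘 ∷ᵛ ⟨⟩ ]
[01] = [ 𝟘 ∷ᵛ 𝟙 ∷ᵛ ⟨⟩ ]
[1*] = [ 𝟙 ∷ᵛ ⋆ ∷ᵛ ⟨⟩ ]
[**] = [ ⋆ ∷ᵛ ⋆ ∷ᵛ ⟨⟩ ]

T♭ : Triple
T♭ = triple 2 2 (3 · [00] ⊕ 3 · [01] ⊕ 3 · [1*]) (3 · H) H

T† : Triple
T† = triple 2 3 (4 · [00] ⊕ 4 · [01] ⊕ 4 · [1*]) (3 · L) L

T‡ : Triple
T‡ = triple 2 4
  (2 · [00] ⊕ 2 · [01] ⊕ 3 · [00] ⊕ 3 · [01] ⊕ 6 · [1*])
  (2 · ([0] ⊙ G ⊙ [**]) ⊕ 2 · ([1] ⊙ [*] ⊙ H) ⊕ [*] ⊙ G ⊙ H)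
  ([0] ⊙ G ⊙ [**] ⊕ [1] ⊙ [*] ⊙ H)

T♯ : Triple
T♯ = triple 2 5
  (2 · (3 · [00] ⊕ 3 · [01]) ⊕ 9 · [1*])
  (2 · ([0] ⊙ H ⊙ [**]) ⊕ 2 · ([1] ⊙ [**] ⊙ H) ⊕ [*] ⊙ H ⊙ H)
  ([0] ⊙ H ⊙ [**] ⊕ [1] ⊙ [**] ⊙ H)

data 𝒯 : ℕ → Triple → Set where
  flat   : 𝒯 0 T♭
  dagger : 𝒯 0 T†
  ddagger : 𝒯 0 T‡
  sharp  : 𝒯 0 T♯
  comp   : ∀ {k S T} → 𝒯 k S → 𝒯 k T → (e : α S ≡ α T) → 𝒯 (suc k) (compound S T e)

-- A compound raises α by one, and β + 1 of a compound is the sum of the β + 1 of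
-- its two factors. So on 𝒯 k we have α = k + 2, and β + 1 is a sum of 2^k values
-- of β + 1 for base triples, which lie in {3, 4, 5, 6}.
module Submission where

open import Defs
open import Data.Nat using (ℕ; suc; _+_; _*_; _^_; _≤_)
open import Data.Nat.Properties
  using (≤-refl; m≤m+n; n≤1+n; +-mono-≤; +-monoˡ-≤; +-assoc; +-suc; +-comm; *-distribˡ-+; +-identityʳ)
open import Data.Product using (_×_; _,_)
open import Relation.Binary.PropositionalEquality
  using (_≡_; refl; cong; sym; subst; module ≡-Reasoning)

suc-β-compound : (S T : Triple) (e : α S ≡ α T) →
  suc (β (compound S T e)) ≡ suc (β S) + suc (β T)
suc-β-compound S T e = cong suc (sym (+-suc (β S) (β T)))

α-𝒯 : ∀ {k S} → 𝒯 k S → α S ≡ 2 + k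
α-𝒯 flat = refl
α-𝒯 dagger = refl
α-𝒯 ddagger = refl
α-𝒯 sharp = refl
α-𝒯 (comp s t e) = cong suc (α-𝒯 s)

*-2^-suc : ∀ n k → n * 2 ^ suc k ≡ n * 2 ^ k + n * 2 ^ k
*-2^-suc n k = begin
  n * (2 ^ k + (2 ^ k + 0)) ≡⟨ cong (λ m → n * (2 ^ k + m)) (+-identityʳ (2 ^ k)) ⟩
  n * (2 ^ k + 2 ^ k)       ≡⟨ *-distribˡ-+ n (2 ^ k) (2 ^ k) ⟩
  n * 2 ^ k + n * 2 ^ k     ∎
  where open ≡-Reasoning

*-2^-suc-≤-+ : ∀ n k {x y} → n * 2 ^ k ≤ x → n * 2 ^ k ≤ y → n * 2 ^ suc k ≤ x + y
*-2^-suc-≤-+ n k {x} {y} p q = subst (_≤ x + y) (sym (*-2^-suc n k)) (+-mono-≤ p q)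

+-≤-*-2^-suc : ∀ n k {x y} → x ≤ n * 2 ^ k → y ≤ n * 2 ^ k → x + y ≤ n * 2 ^ suc k
+-≤-*-2^-suc n k {x} {y} p q = subst (x + y ≤_) (sym (*-2^-suc n k)) (+-mono-≤ p q)

suc-β-𝒯-bounds : ∀ {k S} → 𝒯 k S → 3 * 2 ^ k ≤ suc (β S) × suc (β S) ≤ 6 * 2 ^ k
suc-β-𝒯-bounds flat = ≤-refl , m≤m+n 3 3
suc-β-𝒯-bounds dagger = n≤1+n 3 , m≤m+n 4 2
suc-β-𝒯-bounds ddagger = m≤m+n 3 2 , m≤m+n 5 1
suc-β-𝒯-bounds sharp = m≤m+n 3 3 , ≤-refl
suc-β-𝒯-bounds (comp {k} {S} {T} s t e)
  with suc-β-𝒯-bounds s | suc-β-𝒯-bounds t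
... | lo-S , hi-S | lo-T , hi-T rewrite suc-β-compound S T e =
  *-2^-suc-≤-+ 3 k lo-S lo-T , +-≤-*-2^-suc 6 k hi-S hi-T

δ-𝒯 : ∀ {k S} → 𝒯 k S → δ S ≡ suc (β S) + (k + 1)
δ-𝒯 {k} {S} s = begin
  α S + β S           ≡⟨ cong (_+ β S) (α-𝒯 s) ⟩
  suc (suc k) + β S   ≡⟨ cong suc (+-comm (suc k) (β S)) ⟩
  suc (β S + suc k)   ≡⟨ cong (λ m → suc (β S + m)) (+-comm 1 k) ⟩
  suc (β S) + (k + 1) ∎
  where open ≡-Reasoning

proposition7 : (k : ℕ) (S : Triple) → 𝒯 k S →
    (3 * 2 ^ k + k + 1 ≤ δ S) × (δ S ≤ 6 * 2 ^ k + k + 1)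
proposition7 k S s with suc-β-𝒯-bounds s
... | lo , hi rewrite δ-𝒯 s | +-assoc (3 * 2 ^ k) k 1 | +-assoc (6 * 2 ^ k) k 1 =
  +-monoˡ-≤ (k + 1) lo , +-monoˡ-≤ (k + 1) hi
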